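{- Let $\mathcal{C}$ be a finite biproduct category with idempotent convolution. For all morphisms $f,g\colon X\to Y$, $f\le g$ if and only if $f+g=g$, where $f+g:=\Delta_X;(f\oplus g);\nabla_Y$.
   Context: Composition is diagrammatic. A finite biproduct category is a symmetric monoidal category $(\mathcal{C},\oplus,0)$ where each object $X$ has a commutative monoid $(\nabla_X\colon X\oplus X\to X,¡_X\colon0\to X)$ and cocommutative comonoid $(\Delta_X\colon X\to X\oplus X,!_X\colon X\to0)$, coherent with $\oplus$, and every morphism $f\colon X\to Y$ satisfies $(f\oplus f);\nabla_Y=\nabla_X;f$, $¡_X;f=¡_Y$, $f;\Delta_Y=\Delta_X;(f\oplus f)$, $f;!_Y=!_X$. A finite biproduct category with idempotent convolution is a poset-enriched (homsets are posets, and composition and $\oplus$ are monotone) such category in which, for every $X$: $\mathrm{id}_{X\oplus X}\le\nabla_X;\Delta_X$, $\Delta_X;\nabla_X\le\mathrm{id}_X$, $\mathrm{id}_0\le ¡_X;!_X$, and $!_X;¡_X\le\mathrm{id}_X$. -}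

module Defs where

open import Level using (Level; _⊔_; suc)
open import Relation.Binary using (Rel; IsEquivalence; IsPartialOrder)

-- Composition is diagrammatic:  f ； g  means "first f, then g".

record PosetSMC (o h e r : Level) : Set (suc (o ⊔ h ⊔ e ⊔ r)) where
  infixr 9 _；_
  infixr 10 _⊕₁_
  infixr 10 _⊕_
  infix  4 _≈_ _≤_
  field
    Obj  : Set o
    Hom  : Obj → Obj → Set h
    _≈_  : ∀ {X Y} → Rel (Hom X Y) e
    _≤_  : ∀ {X Y} → Rel (Hom X Y) r
    ≈-equiv   : ∀ {X Y} → IsEquivalence (_≈_ {X} {Y})
    ≤-partial : ∀ {X Y} → IsPartialOrder (_≈_ {X} {Y}) (_≤_ {X} {Y})

    id   : ∀ {X} → Hom X X
    _；_ : ∀ {X Y Z} → Hom X Y → Hom Y Z → Hom X Z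
    identityˡ : ∀ {X Y} {f : Hom X Y} → id ； f ≈ f
    identityʳ : ∀ {X Y} {f : Hom X Y} → f ； id ≈ f
    assoc     : ∀ {W X Y Z} {f : Hom W X} {g : Hom X Y} {k : Hom Y Z} →
                (f ； g) ； k ≈ f ； (g ； k)
    ；-resp-≈  : ∀ {X Y Z} {f f′ : Hom X Y} {g g′ : Hom Y Z} →
                f ≈ f′ → g ≈ g′ → f ； g ≈ f′ ； g′
    ；-mono    : ∀ {X Y Z} {f f′ : Hom X Y} {g g′ : Hom Y Z} →
                f ≤ f′ → g ≤ g′ → f ； g ≤ f′ ； g′

    _⊕_  : Obj → Obj → Obj
    𝟘    : Obj
    _⊕₁_ : ∀ {X Y X′ Y′} → Hom X Y → Hom X′ Y′ → Hom (X ⊕ X′) (Y ⊕ Y′)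
    ⊕-identity : ∀ {X Y} → id {X} ⊕₁ id {Y} ≈ id
    ⊕-homo     : ∀ {X Y Z X′ Y′ Z′} {f : Hom X Y} {g : Hom Y Z}
                 {f′ : Hom X′ Y′} {g′ : Hom Y′ Z′} →
                 (f ； g) ⊕₁ (f′ ； g′) ≈ (f ⊕₁ f′) ； (g ⊕₁ g′)
    ⊕-resp-≈   : ∀ {X Y X′ Y′} {f g : Hom X Y} {f′ g′ : Hom X′ Y′} →
                 f ≈ g → f′ ≈ g′ → f ⊕₁ f′ ≈ g ⊕₁ g′
    ⊕-mono     : ∀ {X Y X′ Y′} {f g : Hom X Y} {f′ g′ : Hom X′ Y′} →
                 f ≤ g → f′ ≤ g′ → f ⊕₁ f′ ≤ g ⊕₁ g′

    α  : ∀ {X Y Z} → Hom ((X ⊕ Y) ⊕ Z) (X ⊕ (Y ⊕ Z))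
    α⁻¹ : ∀ {X Y Z} → Hom (X ⊕ (Y ⊕ Z)) ((X ⊕ Y) ⊕ Z)
    λ′  : ∀ {X} → Hom (𝟘 ⊕ X) X
    λ⁻¹ : ∀ {X} → Hom X (𝟘 ⊕ X)
    ρ   : ∀ {X} → Hom (X ⊕ 𝟘) X
    ρ⁻¹ : ∀ {X} → Hom X (X ⊕ 𝟘)
    σ   : ∀ {X Y} → Hom (X ⊕ Y) (Y ⊕ X)

    α-iso₁ : ∀ {X Y Z} → α {X} {Y} {Z} ； α⁻¹ ≈ id
    α-iso₂ : ∀ {X Y Z} → α⁻¹ ； α {X} {Y} {Z} ≈ id
    λ-iso₁ : ∀ {X} → λ′ {X} ； λ⁻¹ ≈ id
    λ-iso₂ : ∀ {X} → λ⁻¹ ； λ′ {X} ≈ id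
    ρ-iso₁ : ∀ {X} → ρ {X} ； ρ⁻¹ ≈ id
    ρ-iso₂ : ∀ {X} → ρ⁻¹ ； ρ {X} ≈ id
    σ-involutive : ∀ {X Y} → σ {X} {Y} ； σ ≈ id

    α-natural : ∀ {X Y Z X′ Y′ Z′} {f : Hom X X′} {g : Hom Y Y′} {k : Hom Z Z′} →
                ((f ⊕₁ g) ⊕₁ k) ； α ≈ α ； (f ⊕₁ (g ⊕₁ k))
    λ-natural : ∀ {X Y} {f : Hom X Y} → (id {𝟘} ⊕₁ f) ； λ′ ≈ λ′ ； f
    ρ-natural : ∀ {X Y} {f : Hom X Y} → (f ⊕₁ id {𝟘}) ； ρ ≈ ρ ； f
    σ-natural : ∀ {X Y X′ Y′} {f : Hom X X′} {g : Hom Y Y′} →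
                (f ⊕₁ g) ； σ ≈ σ ； (g ⊕₁ f)

    triangle : ∀ {X Y} → α {X} {𝟘} {Y} ； (id ⊕₁ λ′) ≈ ρ ⊕₁ id
    pentagon : ∀ {W X Y Z} →
               (α {W} {X} {Y} ⊕₁ id {Z}) ； α ； (id ⊕₁ α) ≈ α ； α
    hexagon  : ∀ {X Y Z} →
               α {X} {Y} {Z} ； σ ； α ≈ (σ ⊕₁ id) ； α ； (id ⊕₁ σ)

  interchange : ∀ {A B C D} → Hom ((A ⊕ B) ⊕ (C ⊕ D)) ((A ⊕ C) ⊕ (B ⊕ D))
  interchange = α ； (id ⊕₁ α⁻¹) ； (id ⊕₁ (σ ⊕₁ id)) ； (id ⊕₁ α) ； α⁻¹

record FinBiprodIdemConv (o h e r : Level) : Set (suc (o ⊔ h ⊔ e ⊔ r)) where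
  field
    smc : PosetSMC o h e r
  open PosetSMC smc public
  field
    ∇ : ∀ {X} → Hom (X ⊕ X) X
    ¡ : ∀ {X} → Hom 𝟘 X
    Δ : ∀ {X} → Hom X (X ⊕ X)
    ! : ∀ {X} → Hom X 𝟘

    ∇-assoc : ∀ {X} → (∇ ⊕₁ id) ； ∇ ≈ α ； (id ⊕₁ ∇) ； ∇ {X}
    ∇-unitˡ : ∀ {X} → (¡ ⊕₁ id) ； ∇ ≈ λ′ {X}
    ∇-unitʳ : ∀ {X} → (id ⊕₁ ¡) ； ∇ ≈ ρ {X}
    ∇-comm  : ∀ {X} → σ ； ∇ ≈ ∇ {X}
    Δ-assoc : ∀ {X} → Δ {X} ； (Δ ⊕₁ id) ≈ Δ ； (id ⊕₁ Δ) ； α⁻¹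
    Δ-unitˡ : ∀ {X} → Δ ； (! ⊕₁ id) ≈ λ⁻¹ {X}
    Δ-unitʳ : ∀ {X} → Δ ； (id ⊕₁ !) ≈ ρ⁻¹ {X}
    Δ-comm  : ∀ {X} → Δ ； σ ≈ Δ {X}

    ∇-⊕ : ∀ {X Y} → ∇ {X ⊕ Y} ≈ interchange ； (∇ ⊕₁ ∇)
    ¡-⊕ : ∀ {X Y} → ¡ {X ⊕ Y} ≈ λ⁻¹ ； (¡ ⊕₁ ¡)
    Δ-⊕ : ∀ {X Y} → Δ {X ⊕ Y} ≈ (Δ ⊕₁ Δ) ； interchange
    !-⊕ : ∀ {X Y} → ! {X ⊕ Y} ≈ (! ⊕₁ !) ； λ′
    ∇-𝟘 : ∇ {𝟘} ≈ λ′
    ¡-𝟘 : ¡ {𝟘} ≈ id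
    Δ-𝟘 : Δ {𝟘} ≈ λ⁻¹
    !-𝟘 : ! {𝟘} ≈ id

    ∇-natural : ∀ {X Y} {f : Hom X Y} → (f ⊕₁ f) ； ∇ ≈ ∇ ； f
    ¡-natural : ∀ {X Y} {f : Hom X Y} → ¡ ； f ≈ ¡
    Δ-natural : ∀ {X Y} {f : Hom X Y} → f ； Δ ≈ Δ ； (f ⊕₁ f)
    !-natural : ∀ {X Y} {f : Hom X Y} → f ； ! ≈ !

    id≤∇Δ : ∀ {X} → id {X ⊕ X} ≤ ∇ ； Δ
    Δ∇≤id : ∀ {X} → Δ ； ∇ ≤ id {X}
    id≤¡! : ∀ {X} → id {𝟘} ≤ ¡ {X} ； !
    !¡≤id : ∀ {X} → ! ； ¡ ≤ id {X}

  infixl 6 _+_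
  _+_ : ∀ {X Y} → Hom X Y → Hom X Y → Hom X Y
  f + g = Δ ； (f ⊕₁ g) ； ∇

{-# OPTIONS --safe #-}

-- Convolution f + g is commutative and monotone, has the least morphism
-- 0# = ! ； ¡ as its unit (least because ! ； ¡ ≤ id and ! absorbs anything
-- before it), and satisfies g + g ≤ g (because Δ ； ∇ ≤ id).  So f ≤ g gives
-- f + g ≤ g + g ≤ g and g ≈ 0# + g ≤ f + g, while f + g ≈ g gives
-- f ≈ f + 0# ≤ f + g ≈ g.

module Submission where

open import Defs
open import Function.Bundles using (_⇔_; mk⇔)
open import Relation.Binary using (Poset; IsEquivalence; IsPartialOrder)
import Relation.Binary.Reasoning.PartialOrder as PosetReasoning

module Convolution {o h e r} (C : FinBiprodIdemConv o h e r) where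
  open FinBiprodIdemConv C

  private
    module ≈ {X Y} = IsEquivalence (≈-equiv {X} {Y})
    module ≤ {X Y} = IsPartialOrder (≤-partial {X} {Y})

  homPoset : Obj → Obj → Poset h e r
  homPoset X Y = record { isPartialOrder = ≤-partial {X} {Y} }

  ；-congˡ : ∀ {X Y Z} {f : Hom X Y} {g g′ : Hom Y Z} → g ≈ g′ → f ； g ≈ f ； g′
  ；-congˡ = ；-resp-≈ ≈.refl

  ；-congʳ : ∀ {X Y Z} {f f′ : Hom X Y} {g : Hom Y Z} → f ≈ f′ → f ； g ≈ f′ ； g
  ；-congʳ p = ；-resp-≈ p ≈.refl

  0# : ∀ {X Y} → Hom X Y
  0# = ! ； ¡

  +-comm : ∀ {X Y} (f g : Hom X Y) → f + g ≈ g + f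
  +-comm {X} {Y} f g = begin-equality
    Δ ； (f ⊕₁ g) ； ∇          ≈⟨ ；-congʳ Δ-comm ⟨
    (Δ ； σ) ； (f ⊕₁ g) ； ∇   ≈⟨ assoc ⟩
    Δ ； σ ； (f ⊕₁ g) ； ∇     ≈⟨ ；-congˡ (≈.sym assoc) ⟩
    Δ ； (σ ； (f ⊕₁ g)) ； ∇   ≈⟨ ；-congˡ (；-congʳ σ-natural) ⟨
    Δ ； ((g ⊕₁ f) ； σ) ； ∇   ≈⟨ ；-congˡ assoc ⟩
    Δ ； (g ⊕₁ f) ； σ ； ∇     ≈⟨ ；-congˡ (；-congˡ ∇-comm) ⟩
    Δ ； (g ⊕₁ f) ； ∇          ∎
    where open PosetReasoning (homPoset X Y)

  +-mono-≤ : ∀ {X Y} {f f′ g g′ : Hom X Y} → f ≤ f′ → g ≤ g′ → f + g ≤ f′ + g′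
  +-mono-≤ p q = ；-mono ≤.refl (；-mono (⊕-mono p q) ≤.refl)

  Δ；⊕! : ∀ {X Y} (f : Hom X Y) → Δ ； (f ⊕₁ !) ≈ f ； ρ⁻¹
  Δ；⊕! {X} {Y} f = begin-equality
    Δ ； (f ⊕₁ !)                ≈⟨ ；-congˡ (⊕-resp-≈ identityʳ !-natural) ⟨
    Δ ； (f ； id) ⊕₁ (f ； !)   ≈⟨ ；-congˡ ⊕-homo ⟩
    Δ ； (f ⊕₁ f) ； (id ⊕₁ !)   ≈⟨ assoc ⟨
    (Δ ； (f ⊕₁ f)) ； (id ⊕₁ !) ≈⟨ ；-congʳ Δ-natural ⟨
    (f ； Δ) ； (id ⊕₁ !)        ≈⟨ assoc ⟩
    f ； Δ ； (id ⊕₁ !)          ≈⟨ ；-congˡ Δ-unitʳ ⟩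
    f ； ρ⁻¹                     ∎
    where open PosetReasoning (homPoset X (Y ⊕ 𝟘))

  +-identityʳ : ∀ {X Y} (f : Hom X Y) → f + 0# ≈ f
  +-identityʳ {X} {Y} f = begin-equality
    Δ ； (f ⊕₁ (! ； ¡)) ； ∇          ≈⟨ ；-congˡ (；-congʳ (⊕-resp-≈ identityʳ ≈.refl)) ⟨
    Δ ； ((f ； id) ⊕₁ (! ； ¡)) ； ∇  ≈⟨ ；-congˡ (；-congʳ ⊕-homo) ⟩
    Δ ； ((f ⊕₁ !) ； (id ⊕₁ ¡)) ； ∇  ≈⟨ ；-congˡ assoc ⟩
    Δ ； (f ⊕₁ !) ； (id ⊕₁ ¡) ； ∇    ≈⟨ ；-congˡ (；-congˡ ∇-unitʳ) ⟩
    Δ ； (f ⊕₁ !) ； ρ                 ≈⟨ assoc ⟨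
    (Δ ； (f ⊕₁ !)) ； ρ               ≈⟨ ；-congʳ (Δ；⊕! f) ⟩
    (f ； ρ⁻¹) ； ρ                    ≈⟨ assoc ⟩
    f ； ρ⁻¹ ； ρ                      ≈⟨ ；-congˡ ρ-iso₂ ⟩
    f ； id                            ≈⟨ identityʳ ⟩
    f                                  ∎
    where open PosetReasoning (homPoset X Y)

  +-identityˡ : ∀ {X Y} (f : Hom X Y) → 0# + f ≈ f
  +-identityˡ f = ≈.trans (+-comm 0# f) (+-identityʳ f)

  0#-least : ∀ {X Y} (f : Hom X Y) → 0# ≤ f
  0#-least {X} {Y} f = begin
    ! ； ¡         ≈⟨ ；-congʳ !-natural ⟨
    (f ； !) ； ¡  ≈⟨ assoc ⟩
    f ； ! ； ¡    ≤⟨ ；-mono ≤.refl !¡≤id ⟩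
    f ； id        ≈⟨ identityʳ ⟩
    f              ∎
    where open PosetReasoning (homPoset X Y)

  +-idem-≤ : ∀ {X Y} (f : Hom X Y) → f + f ≤ f
  +-idem-≤ {X} {Y} f = begin
    Δ ； (f ⊕₁ f) ； ∇  ≈⟨ ；-congˡ ∇-natural ⟩
    Δ ； ∇ ； f         ≈⟨ assoc ⟨
    (Δ ； ∇) ； f       ≤⟨ ；-mono Δ∇≤id ≤.refl ⟩
    id ； f             ≈⟨ identityˡ ⟩
    f                   ∎
    where open PosetReasoning (homPoset X Y)

  ≤⇔+≈ : ∀ {X Y} (f g : Hom X Y) → (f ≤ g) ⇔ (f + g ≈ g)
  ≤⇔+≈ {X} {Y} f g = mk⇔ ≤⇒+≈ +≈⇒≤
    where
    open PosetReasoning (homPoset X Y)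

    ≤⇒+≈ : f ≤ g → f + g ≈ g
    ≤⇒+≈ f≤g = ≤.antisym f+g≤g g≤f+g
      where
      f+g≤g : f + g ≤ g
      f+g≤g = begin
        f + g  ≤⟨ +-mono-≤ f≤g ≤.refl ⟩
        g + g  ≤⟨ +-idem-≤ g ⟩
        g      ∎
      g≤f+g : g ≤ f + g
      g≤f+g = begin
        g       ≈⟨ +-identityˡ g ⟨
        0# + g  ≤⟨ +-mono-≤ (0#-least f) ≤.refl ⟩
        f + g   ∎

    +≈⇒≤ : f + g ≈ g → f ≤ g
    +≈⇒≤ f+g≈g = begin
      f       ≈⟨ +-identityʳ f ⟨
      f + 0#  ≤⟨ +-mono-≤ ≤.refl (0#-least g) ⟩
      f + g   ≈⟨ f+g≈g ⟩
      g       ∎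

lemma6p2 : ∀ {o h e r} (C : FinBiprodIdemConv o h e r) →
    let open FinBiprodIdemConv C in
    ∀ {X Y} (f g : Hom X Y) → (f ≤ g) ⇔ (f + g ≈ g)
lemma6p2 C = Convolution.≤⇔+≈ C
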